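{- Let $p\geq 2$ be an integer and let $g(m)=\max\{\mathrm{Mad}(G) : e(G)=m\}$. (i) If $m=\binom{p}{2}$, then $g(m)=p-1$, with the unique extremal graph $K_p$. (ii) If $\binom{p}{2}<m<\binom{p+1}{2}$, say $m=\binom{p}{2}+r$ with $0<r<p$, then $g(m)=\max\{p-1,\,2m/(p+1)\}$, and it is attained by precisely the following graphs $G$ with $m$ edges: (a) any $G$ with $K_p\subset G$, if $0<r<\frac{p-1}{2}$; (b) any $G$ with $|V(G)|=p+1$, if $\frac{p-1}{2}<r<p$; (c) both types (a) and (b), if $r=\frac{p-1}{2}$.
   Context: For a finite graph $G$, $e(G)$ is its number of edges and $\mathrm{Mad}(G)=\max\{2e(H)/|V(H)| : H\subseteq G,\ |V(H)|\geq 1\}$. Graphs are considered up to isolated vertices (i.e., without isolated vertices) when identifying extremal graphs. -}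

module Defs where

open import Data.Nat as ℕ using (ℕ; suc; _*_; _∸_; NonZero)
open import Data.Integer using (+_)
open import Data.Rational using (ℚ; _/_; _≤_; _⊔_)
open import Data.Fin as Fin using (Fin)
open import Data.Fin.Subset using (Subset; ∣_∣) renaming (_∈_ to _∈ₛ_)
open import Data.Product using (_×_; _,_; proj₁; proj₂; Σ; ∃)
open import Data.Sum using (_⊎_)
open import Data.List using (List; length)
open import Data.List.Membership.Propositional using (_∈_)
open import Data.List.Relation.Unary.All using (All)
open import Data.List.Relation.Unary.Any using (Any)
open import Data.List.Relation.Unary.Unique.Propositional using (Unique)
open import Data.List.Relation.Binary.Sublist.Propositional using (_⊆_)
open import Relation.Binary.PropositionalEquality using (_≡_; _≢_)
open import Function.Definitions using (Injective)

record Graph : Set where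
  field
    n       : ℕ
    edges   : List (Fin n × Fin n)
    ordered : All (λ e → proj₁ e Fin.< proj₂ e) edges
    unique  : Unique edges
open Graph public

e : Graph → ℕ
e G = length (edges G)

Adj : (G : Graph) → Fin (n G) → Fin (n G) → Set
Adj G i j = ((i , j) ∈ edges G) ⊎ ((j , i) ∈ edges G)

record Subgraph (G : Graph) : Set where
  field
    verts    : Subset (n G)
    hedges   : List (Fin (n G) × Fin (n G))
    sub      : hedges ⊆ edges G
    inside   : All (λ ed → (proj₁ ed ∈ₛ verts) × (proj₂ ed ∈ₛ verts)) hedges
    nonempty : NonZero ∣ verts ∣
open Subgraph public

density : {G : Graph} → Subgraph G → ℚ
density H = (+ (2 * length (hedges H))) / ∣ verts H ∣
  where instance _ = nonempty H

IsMad : Graph → ℚ → Set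
IsMad G q = (∀ (H : Subgraph G) → density H ≤ q) × Σ (Subgraph G) (λ H → density H ≡ q)

IsG : ℕ → ℚ → Set
IsG m q = (∀ (G : Graph) → e G ≡ m → ∀ q' → IsMad G q' → q' ≤ q)
        × Σ Graph (λ G → e G ≡ m × IsMad G q)

NonIsolated : (G : Graph) → Fin (n G) → Set
NonIsolated G v = Any (λ ed → (proj₁ ed ≡ v) ⊎ (proj₂ ed ≡ v)) (edges G)

-- G, after deleting isolated vertices, has exactly k vertices:
-- an injection Fin k → V(G) whose image is exactly the non-isolated vertices.
NonIsolatedCount : Graph → ℕ → Set
NonIsolatedCount G k =
  Σ (Fin k → Fin (n G)) λ f → Injective _≡_ _≡_ f
    × (∀ x → NonIsolated G (f x))
    × (∀ v → NonIsolated G v → ∃ λ x → f x ≡ v)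

ContainsK : ℕ → Graph → Set
ContainsK p G =
  Σ (Fin p → Fin (n G)) λ f → Injective _≡_ _≡_ f
    × (∀ x y → x ≢ y → Adj G (f x) (f y))

IsKUpToIsolated : ℕ → Graph → Set
IsKUpToIsolated p G =
  Σ (Fin p → Fin (n G)) λ f → Injective _≡_ _≡_ f
    × (∀ x y → x ≢ y → Adj G (f x) (f y))
    × (∀ v → NonIsolated G v → ∃ λ x → f x ≡ v)

-- A subgraph H with k vertices has at most C(k,2) edges and at most e(G) of them.  If k ≤ p the
-- first bound gives 2e(H)/k ≤ k − 1 ≤ p − 1; if k ≥ p + 1 the second gives 2e(H)/k ≤ 2e(G)/(p + 1).
-- So Mad(G) ≤ max(p − 1, 2e(G)/(p + 1)) for every p.  Equality in the first case forces k = p and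
-- e(H) = C(p,2), a K_p; in the second it forces k = p + 1 and e(H) = e(G), and as e(G) > C(p,2)
-- no vertex of H is isolated, so G has exactly p + 1 non-isolated vertices.  Which case can occur
-- depends on which of the two values is larger, that is on 2r against p − 1.  K_p plus r edges from
-- a new vertex contains a K_p and has p + 1 vertices, so it attains the bound in every case.

{-# OPTIONS --safe #-}
module Submission where

open import Defs
open import Data.Nat using (ℕ; suc; _+_; _*_; _∸_; _<_; _≤_; _≥_)
open import Data.Nat.Combinatorics using (_C_)
open import Data.Integer using (+_)
open import Data.Rational using (ℚ; _/_; _⊔_)
open import Data.Product using (_×_; _,_)
open import Data.Sum using (_⊎_)
open import Function.Bundles using (_⇔_)
open import Relation.Binary.PropositionalEquality using (_≡_)

open import Data.Integer as ℤ using ()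
import Data.Integer.Properties as ℤₚ
open import Data.Rational as ℚ using ()
import Data.Rational.Properties as ℚₚ
open import Data.Rational.Unnormalised as ℚᵘ using (mkℚᵘ; *≡*; *≤*)
import Data.Rational.Unnormalised.Properties as ℚᵘₚ
open import Function.Bundles using (mk⇔; module Equivalence)
open Equivalence using (to; from)
open import Function.Construct.Composition using (_⇔-∘_)

open import Data.Bool using (true; false)
open import Data.Nat as ℕ using (zero; z≤n; s≤s; NonZero)
import Data.Nat.Properties as ℕₚ
open import Data.Nat.Combinatorics using (nCk+nC[k+1]≡[n+1]C[k+1]; nC1≡n)
open import Data.Fin as Fin using (Fin; zero; suc)
import Data.Fin.Properties as Finₚ
open import Data.Fin.Subset using (Subset; ∣_∣; ⊤; _-_) renaming (_∈_ to _∈ₛ_)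
import Data.Fin.Subset.Properties as Subsetₚ
open import Data.Vec as Vec using ([]; _∷_; here; there)
import Data.Vec.Properties as Vecₚ
open import Data.Product using (Σ; proj₁; proj₂; ∃)
open import Data.Sum using (inj₁; inj₂)
open import Data.List using (List; []; _∷_; length; map; _++_; filter; take; tabulate; allFin)
import Data.List.Properties as Listₚ
open import Data.List.Membership.Propositional using (_∈_; _∉_; _─_; lose)
import Data.List.Membership.Propositional.Properties as ∈ₚ
open import Data.List.Relation.Unary.All as All using (All; []; _∷_)
import Data.List.Relation.Unary.All.Properties as Allₚ
open import Data.List.Relation.Unary.Any as Any using (Any; here; there; index)
open import Data.List.Relation.Unary.AllPairs using ([]; _∷_)
open import Data.List.Relation.Unary.Unique.Propositional using (Unique)
import Data.List.Relation.Unary.Unique.Propositional.Properties as Uniqueₚ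
open import Data.List.Relation.Binary.Disjoint.Propositional using (Disjoint)
open import Data.List.Relation.Binary.Subset.Propositional using (_⊆_)
import Data.List.Relation.Binary.Sublist.Propositional as Sublist
import Data.List.Relation.Binary.Sublist.Propositional.Properties as Sublistₚ
open import Data.Product.Properties using (≡-dec)
open import Function using (_∘_; case_of_)
open import Function.Definitions using (Injective)
open import Relation.Binary.Definitions using (DecidableEquality; tri<; tri≈; tri>)
open import Relation.Binary.PropositionalEquality
  using (refl; sym; trans; cong; cong₂; subst; subst₂; _≢_; module ≡-Reasoning)
open import Relation.Nullary using (¬_; yes; no; does; contradiction; _×-dec_; _⊎-dec_)
open import Relation.Nullary.Decidable using (dec-true)
open import Relation.Unary using (Decidable)
open import Data.Nat.Tactic.RingSolver using (solve-∀)

-- Duplicate-free lists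

module _ {A : Set} where

  ∈-─ : ∀ {x y : A} {ys} (y∈ys : y ∈ ys) → x ∈ ys → x ≢ y → x ∈ ys ─ y∈ys
  ∈-─ (here refl) (here refl)  x≢y = contradiction refl x≢y
  ∈-─ (here refl) (there x∈ys) _   = x∈ys
  ∈-─ (there _)   (here refl)  _   = here refl
  ∈-─ (there y∈ys) (there x∈ys) x≢y = there (∈-─ y∈ys x∈ys x≢y)

  ⊆-─ : ∀ {xs ys : List A} {y} (y∈ys : y ∈ ys) → xs ⊆ ys → y ∉ xs →
        xs ⊆ ys ─ y∈ys
  ⊆-─ y∈ys xs⊆ys y∉xs x∈xs = ∈-─ y∈ys (xs⊆ys x∈xs) λ { refl → y∉xs x∈xs }

  length-─ : ∀ {ys : List A} {y} (y∈ys : y ∈ ys) → length ys ≡ suc (length (ys ─ y∈ys))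
  length-─ {ys} y∈ys = Listₚ.length-removeAt′ ys (index y∈ys)

  unique-⊆⇒length-≤ : ∀ {xs ys : List A} → Unique xs → xs ⊆ ys → length xs ≤ length ys
  unique-⊆⇒length-≤ {[]}                 _            _       = z≤n
  unique-⊆⇒length-≤ {x ∷ xs} {ys} (x∉xs ∷ xs!) x∷xs⊆ys = begin
    suc (length xs)           ≤⟨ s≤s (unique-⊆⇒length-≤ xs! xs⊆ys─x) ⟩
    suc (length (ys ─ x∈ys)) ≡⟨ length-─ x∈ys ⟨
    length ys                 ∎
    where
    open ℕₚ.≤-Reasoning
    x∈ys = x∷xs⊆ys (here refl)
    xs⊆ys─x = ⊆-─ x∈ys (x∷xs⊆ys ∘ there) λ x∈xs → All.lookup x∉xs x∈xs refl

  unique-⊆-length-≥⇒⊇ : DecidableEquality A → ∀ {xs ys : List A} →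
    Unique xs → xs ⊆ ys → length ys ≤ length xs → ys ⊆ xs
  unique-⊆-length-≥⇒⊇ _≟_ {xs} xs! xs⊆ys ∣ys∣≤∣xs∣ {y} y∈ys
    with Any.any? (y ≟_) xs
  ... | yes y∈xs = y∈xs
  ... | no  y∉xs = contradiction
    (subst (_≤ length xs) (length-─ y∈ys) ∣ys∣≤∣xs∣)
    (ℕₚ.≤⇒≯ (unique-⊆⇒length-≤ xs! (⊆-─ y∈ys xs⊆ys y∉xs)))

  Unique-resp-⊆ : ∀ {xs ys : List A} → xs Sublist.⊆ ys → Unique ys → Unique xs
  Unique-resp-⊆ Sublist.[]         []           = []
  Unique-resp-⊆ (_ Sublist.∷ʳ τ)   (_ ∷ ys!)    = Unique-resp-⊆ τ ys!
  Unique-resp-⊆ (refl Sublist.∷ τ) (y∉ys ∷ ys!) =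
    Sublistₚ.All-resp-⊆ τ y∉ys ∷ Unique-resp-⊆ τ ys!

-- Subsets of Fin n: enumeration, ordered pairs and images

enumerate : ∀ {n} (S : Subset n) → Fin ∣ S ∣ → Fin n
enumerate (true  ∷ S) zero    = zero
enumerate (true  ∷ S) (suc i) = suc (enumerate S i)
enumerate (false ∷ S) i       = suc (enumerate S i)

enumerate-injective : ∀ {n} (S : Subset n) → Injective _≡_ _≡_ (enumerate S)
enumerate-injective (true  ∷ S) {zero}  {zero}  _  = refl
enumerate-injective (true  ∷ S) {suc i} {suc j} eq =
  cong suc (enumerate-injective S (Finₚ.suc-injective eq))
enumerate-injective (false ∷ S)                 eq =
  enumerate-injective S (Finₚ.suc-injective eq)

enumerate-∈ : ∀ {n} (S : Subset n) i → enumerate S i ∈ₛ S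
enumerate-∈ (true  ∷ S) zero    = here
enumerate-∈ (true  ∷ S) (suc i) = there (enumerate-∈ S i)
enumerate-∈ (false ∷ S) i       = there (enumerate-∈ S i)

enumerate-surjective : ∀ {n} (S : Subset n) {x} → x ∈ₛ S → ∃ λ i → enumerate S i ≡ x
enumerate-surjective (true ∷ S) here = zero , refl
enumerate-surjective (true ∷ S) (there x∈S) with enumerate-surjective S x∈S
... | i , refl = suc i , refl
enumerate-surjective (false ∷ S) (there x∈S) with enumerate-surjective S x∈S
... | i , refl = i , refl

elements : ∀ {n} → Subset n → List (Fin n)
elements S = tabulate (enumerate S)

length-elements : ∀ {n} (S : Subset n) → length (elements S) ≡ ∣ S ∣
length-elements S = Listₚ.length-tabulate (enumerate S)

elements-unique : ∀ {n} (S : Subset n) → Unique (elements S)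
elements-unique S = Uniqueₚ.tabulate⁺ (enumerate-injective S)

∈-elements⁺ : ∀ {n} {S : Subset n} {x} → x ∈ₛ S → x ∈ elements S
∈-elements⁺ {S = S} x∈S with enumerate-surjective S x∈S
... | i , refl = ∈ₚ.∈-tabulate⁺ i

∈-elements⁻ : ∀ {n} {S : Subset n} {x} → x ∈ elements S → x ∈ₛ S
∈-elements⁻ {S = S} x∈ with ∈ₚ.∈-tabulate⁻ x∈
... | i , refl = enumerate-∈ S i

C₂-suc : ∀ k → suc k C 2 ≡ k + k C 2
C₂-suc k = trans (sym (nCk+nC[k+1]≡[n+1]C[k+1] k 1)) (cong (_+ k C 2) (nC1≡n k))

C₂-mono-≤ : ∀ {a b} → a ≤ b → a C 2 ≤ b C 2
C₂-mono-≤ {zero}          _         = z≤n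
C₂-mono-≤ {suc a} {suc b} (s≤s a≤b) =
  subst₂ _≤_ (sym (C₂-suc a)) (sym (C₂-suc b)) (ℕₚ.+-mono-≤ a≤b (C₂-mono-≤ a≤b))

double-C₂ : ∀ k → 2 * (k C 2) ≡ k * (k ∸ 1)
double-C₂ zero          = refl
double-C₂ (suc zero)    = refl
double-C₂ (suc (suc k)) = begin
  2 * (suc (suc k) C 2)          ≡⟨ cong (2 *_) (C₂-suc (suc k)) ⟩
  2 * (suc k + suc k C 2)        ≡⟨ ℕₚ.*-distribˡ-+ 2 (suc k) (suc k C 2) ⟩
  2 * suc k + 2 * (suc k C 2)    ≡⟨ cong (λ x → 2 * suc k + x) (double-C₂ (suc k)) ⟩
  2 * suc k + suc k * k          ≡⟨ ring k ⟩
  suc (suc k) * suc k            ∎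
  where
  open ≡-Reasoning
  ring : ∀ k → 2 * suc k + suc k * k ≡ suc (suc k) * suc k
  ring = solve-∀

star : ∀ {n} → Fin n → Fin (suc n) × Fin (suc n)
star j = zero , suc j

shift : ∀ {n} → Fin n × Fin n → Fin (suc n) × Fin (suc n)
shift (i , j) = suc i , suc j

star-injective : ∀ {n} → Injective _≡_ _≡_ (star {n})
star-injective refl = refl

shift-injective : ∀ {n} → Injective _≡_ _≡_ (shift {n})
shift-injective {x = _ , _} {_ , _} refl = refl

stars-shifts-disjoint : ∀ {n} (xs : List (Fin n)) (ys : List (Fin n × Fin n)) →
  Disjoint (map star xs) (map shift ys)
stars-shifts-disjoint xs ys (v∈stars , v∈shifts)
  with ∈ₚ.∈-map⁻ star v∈stars | ∈ₚ.∈-map⁻ shift v∈shifts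
... | _ , _ , refl | (_ , _) , _ , ()

pairs : ∀ {n} → Subset n → List (Fin n × Fin n)
pairs []          = []
pairs (true  ∷ S) = map star (elements S) ++ map shift (pairs S)
pairs (false ∷ S) = map shift (pairs S)

length-pairs : ∀ {n} (S : Subset n) → length (pairs S) ≡ ∣ S ∣ C 2
length-pairs []          = refl
length-pairs (true  ∷ S) = begin
  length (map star (elements S) ++ map shift (pairs S))
    ≡⟨ Listₚ.length-++ (map star (elements S)) ⟩
  length (map star (elements S)) + length (map shift (pairs S))
    ≡⟨ cong₂ _+_ (trans (Listₚ.length-map star (elements S)) (length-elements S))
                 (trans (Listₚ.length-map shift (pairs S)) (length-pairs S)) ⟩
  (∣ S ∣) + ∣ S ∣ C 2
    ≡⟨ C₂-suc ∣ S ∣ ⟨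
  suc ∣ S ∣ C 2 ∎
  where open ≡-Reasoning
length-pairs (false ∷ S) = trans (Listₚ.length-map shift (pairs S)) (length-pairs S)

pairs-unique : ∀ {n} (S : Subset n) → Unique (pairs S)
pairs-unique []          = []
pairs-unique (true  ∷ S) = Uniqueₚ.++⁺
  (Uniqueₚ.map⁺ star-injective (elements-unique S))
  (Uniqueₚ.map⁺ shift-injective (pairs-unique S))
  (stars-shifts-disjoint (elements S) (pairs S))
pairs-unique (false ∷ S) = Uniqueₚ.map⁺ shift-injective (pairs-unique S)

Ordered : ∀ {n} → Fin n × Fin n → Set
Ordered e = proj₁ e Fin.< proj₂ e

Within : ∀ {n} → Subset n → Fin n × Fin n → Set
Within S e = (proj₁ e ∈ₛ S) × (proj₂ e ∈ₛ S)

Within? : ∀ {n} (S : Subset n) → Decidable (Within S)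
Within? S e = (proj₁ e Subsetₚ.∈? S) ×-dec (proj₂ e Subsetₚ.∈? S)

∈-pairs⁺ : ∀ {n} {S : Subset n} {e} → Ordered e → Within S e → e ∈ pairs S
∈-pairs⁺ {S = true  ∷ S} {zero  , suc j} _         (here , there j∈S) =
  ∈ₚ.∈-++⁺ˡ (∈ₚ.∈-map⁺ star (∈-elements⁺ j∈S))
∈-pairs⁺ {S = true  ∷ S} {suc i , suc j} (s≤s i<j) (there i∈S , there j∈S) =
  ∈ₚ.∈-++⁺ʳ (map star (elements S)) (∈ₚ.∈-map⁺ shift (∈-pairs⁺ i<j (i∈S , j∈S)))
∈-pairs⁺ {S = false ∷ S} {suc i , suc j} (s≤s i<j) (there i∈S , there j∈S) =
  ∈ₚ.∈-map⁺ shift (∈-pairs⁺ i<j (i∈S , j∈S))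

∈-pairs⁻ : ∀ {n} {S : Subset n} {e} → e ∈ pairs S → Ordered e × Within S e
∈-pairs⁻ {S = true ∷ S} e∈ with ∈ₚ.∈-++⁻ (map star (elements S)) e∈
... | inj₁ e∈stars with ∈ₚ.∈-map⁻ star e∈stars
...   | _ , j∈ , refl = s≤s z≤n , here , there (∈-elements⁻ j∈)
∈-pairs⁻ {S = true ∷ S} e∈ | inj₂ e∈shifts with ∈ₚ.∈-map⁻ shift e∈shifts
... | (_ , _) , e∈pairs , refl with ∈-pairs⁻ e∈pairs
...   | i<j , i∈S , j∈S = s≤s i<j , there i∈S , there j∈S
∈-pairs⁻ {S = false ∷ S} e∈ with ∈ₚ.∈-map⁻ shift e∈
... | (_ , _) , e∈pairs , refl with ∈-pairs⁻ e∈pairs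
...   | i<j , i∈S , j∈S = s≤s i<j , there i∈S , there j∈S

pairs-ordered : ∀ {n} (S : Subset n) → All Ordered (pairs S)
pairs-ordered S = All.tabulate λ e∈ → proj₁ (∈-pairs⁻ {S = S} e∈)

module _ {n} (S : Subset n) {es : List (Fin n × Fin n)}
         (es! : Unique es) (es< : All Ordered es) (es⊆S : All (Within S) es) where

  ⊆-pairs : es ⊆ pairs S
  ⊆-pairs e∈ = ∈-pairs⁺ (All.lookup es< e∈) (All.lookup es⊆S e∈)

  length≤C₂ : length es ≤ ∣ S ∣ C 2
  length≤C₂ = subst (length es ≤_) (length-pairs S) (unique-⊆⇒length-≤ es! ⊆-pairs)

  C₂≤length⇒pairs⊆ : ∣ S ∣ C 2 ≤ length es → pairs S ⊆ es
  C₂≤length⇒pairs⊆ C₂≤ = unique-⊆-length-≥⇒⊇ (≡-dec Finₚ._≟_ Finₚ._≟_) es! ⊆-pairs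
    (subst (_≤ length es) (sym (length-pairs S)) C₂≤)

image : ∀ {k n} → (Fin k → Fin n) → Subset n
image f = Vec.tabulate λ v → does (Finₚ.any? λ x → f x Finₚ.≟ v)

∈-image⁺ : ∀ {k n} (f : Fin k → Fin n) x → f x ∈ₛ image f
∈-image⁺ f x = Vecₚ.lookup⇒[]= (f x) (image f)
  (trans (Vecₚ.lookup∘tabulate _ (f x)) (dec-true (Finₚ.any? _) (x , refl)))

∈-image⁻ : ∀ {k n} (f : Fin k → Fin n) {v} → v ∈ₛ image f → ∃ λ x → f x ≡ v
∈-image⁻ f {v} v∈ with Finₚ.any? (λ x → f x Finₚ.≟ v)
                     | trans (sym (Vecₚ.lookup∘tabulate _ v)) (Vecₚ.[]=⇒lookup v∈)
... | yes fx≡v | _ = fx≡v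
... | no  _    | ()

injective⇒∣image∣≡ : ∀ {k n} {f : Fin k → Fin n} → Injective _≡_ _≡_ f → ∣ image f ∣ ≡ k
injective⇒∣image∣≡ {f = f} f-inj = ℕₚ.≤-antisym
  (subst₂ _≤_ (length-elements (image f)) (Listₚ.length-tabulate f)
    (unique-⊆⇒length-≤ (elements-unique (image f)) image⊆))
  (subst₂ _≤_ (Listₚ.length-tabulate f) (length-elements (image f))
    (unique-⊆⇒length-≤ (Uniqueₚ.tabulate⁺ f-inj) ⊆image))
  where
  image⊆ : elements (image f) ⊆ tabulate f
  image⊆ v∈ with ∈-image⁻ f (∈-elements⁻ v∈)
  ... | x , refl = ∈ₚ.∈-tabulate⁺ x
  ⊆image : tabulate f ⊆ elements (image f)
  ⊆image v∈ with ∈ₚ.∈-tabulate⁻ v∈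
  ... | x , refl = ∈-elements⁺ (∈-image⁺ f x)

nonZero-image : ∀ {k n} {f : Fin k → Fin n} → Injective _≡_ _≡_ f → {{NonZero k}} →
  NonZero ∣ image f ∣
nonZero-image f-inj {{k≢0}} = subst NonZero (sym (injective⇒∣image∣≡ f-inj)) k≢0

-- Subgraphs, cliques and edge covers

module _ {G : Graph} where

  order : Subgraph G → ℕ
  order H = ∣ verts H ∣

  size : Subgraph G → ℕ
  size H = length (hedges H)

  hedges-unique : (H : Subgraph G) → Unique (hedges H)
  hedges-unique H = Unique-resp-⊆ (sub H) (unique G)

  hedges-ordered : (H : Subgraph G) → All Ordered (hedges H)
  hedges-ordered H = Sublistₚ.All-resp-⊆ (sub H) (ordered G)

  hedges⊆edges : (H : Subgraph G) → hedges H ⊆ edges G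
  hedges⊆edges H = Sublistₚ.Any-resp-⊆ (sub H)

  size≤e : (H : Subgraph G) → size H ≤ e G
  size≤e H = Sublistₚ.length-mono-≤ (sub H)

  size≤order-C₂ : (H : Subgraph G) → size H ≤ order H C 2
  size≤order-C₂ H = length≤C₂ (verts H) (hedges-unique H) (hedges-ordered H) (inside H)

  induced : (S : Subset (n G)) → {{NonZero ∣ S ∣}} → Subgraph G
  induced S {{S≢∅}} = record
    { verts    = S
    ; hedges   = filter (Within? S) (edges G)
    ; sub      = Sublistₚ.filter-⊆ (Within? S) (edges G)
    ; inside   = Allₚ.all-filter (Within? S) (edges G)
    ; nonempty = S≢∅
    }

  Clique : Subset (n G) → Set
  Clique S = pairs S ⊆ edges G

  Clique⇒ContainsK : ∀ S → Clique S → ContainsK ∣ S ∣ G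
  Clique⇒ContainsK S clique = enumerate S , enumerate-injective S , adjacent
    where
    adjacent : ∀ x y → x ≢ y → Adj G (enumerate S x) (enumerate S y)
    adjacent x y x≢y with Finₚ.<-cmp (enumerate S x) (enumerate S y)
    ... | tri< u<v _ _ = inj₁ (clique (∈-pairs⁺ u<v (enumerate-∈ S x , enumerate-∈ S y)))
    ... | tri≈ _ u≡v _ = contradiction (enumerate-injective S u≡v) x≢y
    ... | tri> _ _ v<u = inj₂ (clique (∈-pairs⁺ v<u (enumerate-∈ S y , enumerate-∈ S x)))

  ContainsK⇒Clique : ∀ {k} (K : ContainsK k G) → Clique (image (proj₁ K))
  ContainsK⇒Clique (f , _ , adjacent) {u , v} uv∈ with ∈-pairs⁻ uv∈
  ... | u<v , u∈ , v∈ with ∈-image⁻ f u∈ | ∈-image⁻ f v∈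
  ... | x , refl | y , refl with adjacent x y (λ { refl → Finₚ.<-irrefl refl u<v })
  ... | inj₁ uv∈G = uv∈G
  ... | inj₂ vu∈G = contradiction (All.lookup (ordered G) vu∈G) (Finₚ.<-asym u<v)

  C₂≤size⇒Clique : (H : Subgraph G) → order H C 2 ≤ size H → Clique (verts H)
  C₂≤size⇒Clique H C₂≤size e∈ = hedges⊆edges H
    (C₂≤length⇒pairs⊆ (verts H) (hedges-unique H) (hedges-ordered H) (inside H) C₂≤size e∈)

  Clique⇒C₂≤size : ∀ S {{_ : NonZero ∣ S ∣}} → Clique S → ∣ S ∣ C 2 ≤ size (induced S)
  Clique⇒C₂≤size S clique = subst (_≤ size (induced S)) (length-pairs S)
    (unique-⊆⇒length-≤ (pairs-unique S) λ e∈ →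
      ∈ₚ.∈-filter⁺ (Within? S) (clique e∈) (proj₂ (∈-pairs⁻ e∈)))

  ContainsK⇒clique-subgraph : ∀ {k} {{_ : NonZero k}} → ContainsK k G →
    Σ (Subgraph G) λ H → order H ≡ k × size H ≡ k C 2
  ContainsK⇒clique-subgraph {k} K@(f , f-inj , _) = H , injective⇒∣image∣≡ f-inj , size≡
    where
    instance _ = nonZero-image f-inj
    H = induced (image f)
    size≡ : size H ≡ k C 2
    size≡ = trans (ℕₚ.≤-antisym (size≤order-C₂ H) (Clique⇒C₂≤size (image f) (ContainsK⇒Clique K)))
                  (cong (_C 2) (injective⇒∣image∣≡ f-inj))

  nonIsolated? : Decidable (NonIsolated G)
  nonIsolated? v = Any.any? (λ e → (proj₁ e Finₚ.≟ v) ⊎-dec (proj₂ e Finₚ.≟ v)) (edges G)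

  Covers : Subset (n G) → Set
  Covers S = All (Within S) (edges G)

  Covers⇒size-induced≡e : ∀ {S} {{_ : NonZero ∣ S ∣}} → Covers S → size (induced S) ≡ e G
  Covers⇒size-induced≡e {S} covers = cong length (Listₚ.filter-all (Within? S) covers)

  e≤size⇒Covers : (H : Subgraph G) → e G ≤ size H → Covers (verts H)
  e≤size⇒Covers H e≤size = All.tabulate λ e∈ → All.lookup (inside H)
    (unique-⊆-length-≥⇒⊇ (≡-dec Finₚ._≟_ Finₚ._≟_) (hedges-unique H) (hedges⊆edges H) e≤size e∈)

  Covers⇒∋nonIsolated : ∀ {S} → Covers S → ∀ {v} → NonIsolated G v → v ∈ₛ S
  Covers⇒∋nonIsolated {S} covers {v} = All.lookupWith {R = λ _ → v ∈ₛ S} endpoint covers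
    where
    endpoint : ∀ {e} → Within S e → proj₁ e ≡ v ⊎ proj₂ e ≡ v → v ∈ₛ S
    endpoint (u∈ , _) (inj₁ refl) = u∈
    endpoint (_ , w∈) (inj₂ refl) = w∈

  NonIsolatedCount⇒Covers : ∀ {k} (N : NonIsolatedCount G k) → Covers (image (proj₁ N))
  NonIsolatedCount⇒Covers (f , _ , _ , onto) = All.tabulate λ e∈ →
    ∈-image (lose e∈ (inj₁ refl)) , ∈-image (lose e∈ (inj₂ refl))
    where
    ∈-image : ∀ {v} → NonIsolated G v → v ∈ₛ image f
    ∈-image used with onto _ used
    ... | x , refl = ∈-image⁺ f x

  isolated⇒e≤C₂ : ∀ {S v} → Covers S → ¬ NonIsolated G v → e G ≤ ∣ S - v ∣ C 2
  isolated⇒e≤C₂ {S} {v} covers isolated =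
    length≤C₂ (S - v) (unique G) (ordered G) (All.tabulate avoids-v)
    where
    avoids-v : ∀ {e} → e ∈ edges G → Within (S - v) e
    avoids-v e∈ =
        Subsetₚ.x∈p∧x≢y⇒x∈p-y (proj₁ (All.lookup covers e∈)) (isolated ∘ lose e∈ ∘ inj₁)
      , Subsetₚ.x∈p∧x≢y⇒x∈p-y (proj₂ (All.lookup covers e∈)) (isolated ∘ lose e∈ ∘ inj₂)

  -- An isolated vertex of S would leave all e(G) edges on the other k vertices of S.
  Covers⇒NonIsolatedCount : ∀ {S k} → Covers S → ∣ S ∣ ≡ suc k → k C 2 < e G →
    NonIsolatedCount G (suc k)
  Covers⇒NonIsolatedCount {S} {k} covers ∣S∣≡ C₂<e = subst (NonIsolatedCount G) ∣S∣≡
    ( enumerate S , enumerate-injective S , used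
    , λ _ → enumerate-surjective S ∘ Covers⇒∋nonIsolated covers )
    where
    used : ∀ x → NonIsolated G (enumerate S x)
    used x with nonIsolated? (enumerate S x)
    ... | yes x-used = x-used
    ... | no  x-isolated = contradiction
      (ℕₚ.≤-trans (isolated⇒e≤C₂ covers x-isolated) (C₂-mono-≤ ∣S-x∣≤k))
      (ℕₚ.<⇒≱ C₂<e)
      where
      ∣S-x∣≤k : ∣ S - enumerate S x ∣ ≤ k
      ∣S-x∣≤k = ℕ.s≤s⁻¹ (subst (∣ S - enumerate S x ∣ <_) ∣S∣≡
                                (Subsetₚ.x∈p⇒∣p-x∣<∣p∣ (enumerate-∈ S x)))

  ContainsK⇒IsKUpToIsolated : ∀ {k} {{_ : NonZero k}} → e G ≤ k C 2 → ContainsK k G →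
    IsKUpToIsolated k G
  ContainsK⇒IsKUpToIsolated {k} e≤C₂ K@(f , f-inj , adjacent) = f , f-inj , adjacent , onto
    where
    instance _ = nonZero-image f-inj
    C₂≤size : k C 2 ≤ size (induced (image f))
    C₂≤size = subst (λ j → j C 2 ≤ size (induced (image f))) (injective⇒∣image∣≡ f-inj)
                    (Clique⇒C₂≤size (image f) (ContainsK⇒Clique K))
    covers : Covers (image f)
    covers = e≤size⇒Covers (induced (image f)) (ℕₚ.≤-trans e≤C₂ C₂≤size)
    onto : ∀ v → NonIsolated G v → ∃ λ x → f x ≡ v
    onto v used = ∈-image⁻ f (Covers⇒∋nonIsolated covers used)

-- Densities

-- (+ a) / suc b unfolds to fromℚᵘ (mkℚᵘ (+ a) b), so both sides can be compared in ℚᵘ.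
fraction-≤⇔ : ∀ a b c d .{{_ : NonZero b}} .{{_ : NonZero d}} →
  ((+ a) / b ℚ.≤ (+ c) / d) ⇔ (a * d ≤ c * b)
fraction-≤⇔ a (suc b) c (suc d) = mk⇔
  (λ x≤y → fromℚᵘ (ℚᵘₚ.≤-respˡ-≃ (ℚₚ.toℚᵘ-fromℚᵘ x)
                   (ℚᵘₚ.≤-respʳ-≃ (ℚₚ.toℚᵘ-fromℚᵘ y) (ℚₚ.toℚᵘ-mono-≤ x≤y))))
  (λ ad≤cb → ℚₚ.toℚᵘ-cancel-≤ (ℚᵘₚ.≤-respˡ-≃ (ℚᵘₚ.≃-sym (ℚₚ.toℚᵘ-fromℚᵘ x))
                               (ℚᵘₚ.≤-respʳ-≃ (ℚᵘₚ.≃-sym (ℚₚ.toℚᵘ-fromℚᵘ y)) (toℚᵘ ad≤cb))))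
  where
  x = mkℚᵘ (+ a) b
  y = mkℚᵘ (+ c) d
  toℚᵘ : a * suc d ≤ c * suc b → x ℚᵘ.≤ y
  toℚᵘ ad≤cb = *≤* (subst₂ ℤ._≤_ (ℤₚ.pos-* a (suc d)) (ℤₚ.pos-* c (suc b)) (ℤ.+≤+ ad≤cb))
  fromℚᵘ : x ℚᵘ.≤ y → a * suc d ≤ c * suc b
  fromℚᵘ (*≤* ad≤cb) =
    ℤₚ.drop‿+≤+ (subst₂ ℤ._≤_ (sym (ℤₚ.pos-* a (suc d))) (sym (ℤₚ.pos-* c (suc b))) ad≤cb)

fraction-≡⇔ : ∀ a b c d .{{_ : NonZero b}} .{{_ : NonZero d}} →
  ((+ a) / b ≡ (+ c) / d) ⇔ (a * d ≡ c * b)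
fraction-≡⇔ a (suc b) c (suc d) = mk⇔
  (λ x≡y → fromℚᵘ (ℚₚ.fromℚᵘ-injective {x} {y} x≡y))
  (λ ad≡cb → ℚₚ.fromℚᵘ-cong {x} {y}
    (*≡* (trans (sym (ℤₚ.pos-* a (suc d))) (trans (cong +_ ad≡cb) (ℤₚ.pos-* c (suc b))))))
  where
  x = mkℚᵘ (+ a) b
  y = mkℚᵘ (+ c) d
  fromℚᵘ : x ℚᵘ.≃ y → a * suc d ≡ c * suc b
  fromℚᵘ (*≡* ad≡cb) =
    ℤₚ.+-injective (trans (ℤₚ.pos-* a (suc d)) (trans ad≡cb (sym (ℤₚ.pos-* c (suc b)))))

module _ {G : Graph} (H : Subgraph G) (a b : ℕ) .{{_ : NonZero b}} where

  density≤⇔ : (density H ℚ.≤ (+ a) / b) ⇔ (2 * size H * b ≤ a * order H)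
  density≤⇔ = fraction-≤⇔ (2 * size H) (order H) a b {{nonempty H}}

  density≡⇔ : (density H ≡ (+ a) / b) ⇔ (2 * size H * b ≡ a * order H)
  density≡⇔ = fraction-≡⇔ (2 * size H) (order H) a b {{nonempty H}}

small-order-bound : ∀ {p k h} → k ≤ p → h ≤ k C 2 → 2 * h * 1 ≤ (p ∸ 1) * k
small-order-bound {p} {k} {h} k≤p h≤C₂ = begin
  2 * h * 1    ≡⟨ ℕₚ.*-identityʳ (2 * h) ⟩
  2 * h        ≤⟨ ℕₚ.*-monoʳ-≤ 2 h≤C₂ ⟩
  2 * (k C 2)  ≡⟨ double-C₂ k ⟩
  k * (k ∸ 1)  ≤⟨ ℕₚ.*-monoʳ-≤ k (ℕₚ.∸-monoˡ-≤ 1 k≤p) ⟩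
  k * (p ∸ 1)  ≡⟨ ℕₚ.*-comm k (p ∸ 1) ⟩
  (p ∸ 1) * k  ∎
  where open ℕₚ.≤-Reasoning

small-order-equality : ∀ {p k h} .{{_ : NonZero k}} → k ≤ p → h ≤ k C 2 →
  2 * h * 1 ≡ (p ∸ 1) * k → k ≡ p × h ≡ p C 2
small-order-equality {suc p} {suc k} {h} (s≤s k≤p) h≤C₂ 2h≡pk = cong suc k≡p , h≡C₂
  where
  k≡p : k ≡ p
  k≡p = ℕₚ.≤-antisym k≤p (ℕₚ.*-cancelʳ-≤ p k (suc k) (begin
    p * suc k    ≡⟨ 2h≡pk ⟨
    2 * h * 1    ≤⟨ small-order-bound {suc k} ℕₚ.≤-refl h≤C₂ ⟩
    k * suc k    ∎))
    where open ℕₚ.≤-Reasoning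
  h≡C₂ : h ≡ suc p C 2
  h≡C₂ = ℕₚ.*-cancelˡ-≡ h (suc p C 2) 2 (begin
    2 * h            ≡⟨ ℕₚ.*-identityʳ (2 * h) ⟨
    2 * h * 1        ≡⟨ 2h≡pk ⟩
    p * suc k        ≡⟨ cong (λ j → p * suc j) k≡p ⟩
    p * suc p        ≡⟨ ℕₚ.*-comm p (suc p) ⟩
    suc p * p        ≡⟨ double-C₂ (suc p) ⟨
    2 * (suc p C 2)  ∎)
    where open ≡-Reasoning

large-order-bound : ∀ {p k h m} → suc p ≤ k → h ≤ m → 2 * h * suc p ≤ 2 * m * k
large-order-bound p<k h≤m = ℕₚ.*-mono-≤ (ℕₚ.*-monoʳ-≤ 2 h≤m) p<k

large-order-equality : ∀ {p k h m} .{{_ : NonZero m}} → suc p ≤ k → h ≤ m →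
  2 * h * suc p ≡ 2 * m * k → k ≡ suc p × h ≡ m
large-order-equality {p} {k} {h} {m} p<k h≤m 2h≡mk = k≡ , h≡m
  where
  instance _ = ℕₚ.m*n≢0 2 m
  k≡ : k ≡ suc p
  k≡ = ℕₚ.≤-antisym (ℕₚ.*-cancelˡ-≤ (2 * m)
         (subst (_≤ 2 * m * suc p) 2h≡mk (ℕₚ.*-monoˡ-≤ (suc p) (ℕₚ.*-monoʳ-≤ 2 h≤m))))
       p<k
  h≡m : h ≡ m
  h≡m = ℕₚ.*-cancelˡ-≡ h m 2 (ℕₚ.*-cancelʳ-≡ (2 * h) (2 * m) (suc p)
          (trans 2h≡mk (cong (2 * m *_) k≡)))

cliqueDensity : ℕ → ℚ
cliqueDensity p = (+ (p ∸ 1)) / 1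

spanDensity : ℕ → ℕ → ℚ
spanDensity p m = (+ (2 * m)) / suc p

madBound : ℕ → ℕ → ℚ
madBound p m = cliqueDensity p ⊔ spanDensity p m

clique≤span⇒C₂< : ∀ {p m} → 2 ≤ p → cliqueDensity p ℚ.≤ spanDensity p m → p C 2 < m
clique≤span⇒C₂< {p@(suc (suc d))} {m} (s≤s (s≤s z≤n)) clique≤span =
  ℕₚ.*-cancelˡ-< 2 (p C 2) m (begin-strict
  2 * (p C 2)    ≡⟨ double-C₂ p ⟩
  p * suc d      ≡⟨ ℕₚ.*-comm p (suc d) ⟩
  suc d * p      <⟨ ℕₚ.*-monoʳ-< (suc d) (ℕₚ.n<1+n p) ⟩
  suc d * suc p  ≤⟨ to (fraction-≤⇔ (suc d) 1 (2 * m) (suc p)) clique≤span ⟩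
  2 * m * 1      ≡⟨ ℕₚ.*-identityʳ (2 * m) ⟩
  2 * m          ∎)
  where open ℕₚ.≤-Reasoning

module _ (p r : ℕ) where

  private
    double-edges : 2 * (p C 2 + r) * 1 ≡ (p ∸ 1) * p + 2 * r
    double-edges = begin
      2 * (p C 2 + r) * 1      ≡⟨ ℕₚ.*-identityʳ _ ⟩
      2 * (p C 2 + r)          ≡⟨ ℕₚ.*-distribˡ-+ 2 (p C 2) r ⟩
      2 * (p C 2) + 2 * r      ≡⟨ cong (_+ 2 * r) (trans (double-C₂ p) (ℕₚ.*-comm p (p ∸ 1))) ⟩
      (p ∸ 1) * p + 2 * r      ∎
      where open ≡-Reasoning

    clique-edges : (p ∸ 1) * suc p ≡ (p ∸ 1) * p + (p ∸ 1)
    clique-edges = trans (ℕₚ.*-suc (p ∸ 1) p) (ℕₚ.+-comm (p ∸ 1) _)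

  span≤clique⇔ : (spanDensity p (p C 2 + r) ℚ.≤ cliqueDensity p) ⇔ (2 * r ≤ p ∸ 1)
  span≤clique⇔ = mk⇔
    (λ le → ℕₚ.+-cancelˡ-≤ _ _ _ (subst₂ _≤_ double-edges clique-edges le))
    (λ le → subst₂ _≤_ (sym double-edges) (sym clique-edges) (ℕₚ.+-monoʳ-≤ _ le))
    ⇔-∘ fraction-≤⇔ (2 * (p C 2 + r)) (suc p) (p ∸ 1) 1

  clique≤span⇔ : (cliqueDensity p ℚ.≤ spanDensity p (p C 2 + r)) ⇔ (p ∸ 1 ≤ 2 * r)
  clique≤span⇔ = mk⇔
    (λ le → ℕₚ.+-cancelˡ-≤ _ _ _ (subst₂ _≤_ clique-edges double-edges le))
    (λ le → subst₂ _≤_ (sym clique-edges) (sym double-edges) (ℕₚ.+-monoʳ-≤ _ le))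
    ⇔-∘ fraction-≤⇔ (p ∸ 1) 1 (2 * (p C 2 + r)) (suc p)

module _ {x y z : ℚ} where

  ⊔-attainedˡ : x ℚ.≤ y → x ≡ y ⊔ z → x ≡ y × z ℚ.≤ y
  ⊔-attainedˡ x≤y x≡y⊔z =
      ℚₚ.≤-antisym x≤y (subst (y ℚ.≤_) (sym x≡y⊔z) (ℚₚ.p≤p⊔q y z))
    , ℚₚ.p⊔q≤r⇒q≤r y z (subst (ℚ._≤ y) x≡y⊔z x≤y)

  ⊔-attainedʳ : x ℚ.≤ z → x ≡ y ⊔ z → x ≡ z × y ℚ.≤ z
  ⊔-attainedʳ x≤z x≡y⊔z =
      ℚₚ.≤-antisym x≤z (subst (z ℚ.≤_) (sym x≡y⊔z) (ℚₚ.p≤q⊔p y z))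
    , ℚₚ.p⊔q≤r⇒p≤r y z (subst (ℚ._≤ z) x≡y⊔z x≤z)

-- Extremal graphs

Extremal : ℕ → ℕ → Graph → Set
Extremal p m G = (spanDensity p m ℚ.≤ cliqueDensity p × ContainsK p G)
               ⊎ (cliqueDensity p ℚ.≤ spanDensity p m × NonIsolatedCount G (suc p))

module _ (p : ℕ) {G : Graph} (H : Subgraph G) where

  density≤cliqueDensity : order H ≤ p → density H ℚ.≤ cliqueDensity p
  density≤cliqueDensity k≤p = from (density≤⇔ H (p ∸ 1) 1) (small-order-bound k≤p (size≤order-C₂ H))

  density≤spanDensity : p < order H → density H ℚ.≤ spanDensity p (e G)
  density≤spanDensity p<k = from (density≤⇔ H (2 * e G) (suc p)) (large-order-bound p<k (size≤e H))

  density≤madBound : density H ℚ.≤ madBound p (e G)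
  density≤madBound = case order H ℕ.≤? p of λ where
    (yes k≤p) → ℚₚ.p≤q⇒p≤q⊔r (spanDensity p (e G)) (density≤cliqueDensity k≤p)
    (no  k≰p) → ℚₚ.p≤q⇒p≤r⊔q (cliqueDensity p) (density≤spanDensity (ℕₚ.≰⇒> k≰p))

  density≡cliqueDensity : order H ≡ p → size H ≡ p C 2 → density H ≡ cliqueDensity p
  density≡cliqueDensity k≡p h≡C₂ = from (density≡⇔ H (p ∸ 1) 1) (begin
    2 * size H * 1   ≡⟨ ℕₚ.*-identityʳ _ ⟩
    2 * size H       ≡⟨ cong (2 *_) h≡C₂ ⟩
    2 * (p C 2)      ≡⟨ double-C₂ p ⟩
    p * (p ∸ 1)      ≡⟨ ℕₚ.*-comm p (p ∸ 1) ⟩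
    (p ∸ 1) * p      ≡⟨ cong ((p ∸ 1) *_) k≡p ⟨
    (p ∸ 1) * order H ∎)
    where open ≡-Reasoning

  density≡spanDensity : order H ≡ suc p → size H ≡ e G → density H ≡ spanDensity p (e G)
  density≡spanDensity k≡ h≡e = from (density≡⇔ H (2 * e G) (suc p))
    (cong₂ (λ h k → 2 * h * k) h≡e (sym k≡))

module _ {p : ℕ} (p≥2 : 2 ≤ p) {G : Graph} where

  private instance
    p≢0 : NonZero p
    p≢0 = ℕ.>-nonZero (ℕₚ.<-≤-trans (s≤s z≤n) p≥2)

  ContainsK⇒madBound-attained : ContainsK p G → spanDensity p (e G) ℚ.≤ cliqueDensity p →
    Σ (Subgraph G) λ H → density H ≡ madBound p (e G)
  ContainsK⇒madBound-attained K span≤clique = let H , k≡p , h≡C₂ = ContainsK⇒clique-subgraph K in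
    H , trans (density≡cliqueDensity p H k≡p h≡C₂) (sym (ℚₚ.p≥q⇒p⊔q≡p span≤clique))

  spanning⇒density≡madBound : (H : Subgraph G) → order H ≡ suc p → size H ≡ e G →
    cliqueDensity p ℚ.≤ spanDensity p (e G) → density H ≡ madBound p (e G)
  spanning⇒density≡madBound H k≡ h≡e clique≤span =
    trans (density≡spanDensity p H k≡ h≡e) (sym (ℚₚ.p≤q⇒p⊔q≡q clique≤span))

  clique-subgraph⇒ContainsK : (H : Subgraph G) → order H ≤ p → density H ≡ cliqueDensity p →
    ContainsK p G
  clique-subgraph⇒ContainsK H k≤p dH≡ = subst (λ k → ContainsK k G) (proj₁ k≡p×h≡C₂)
    (Clique⇒ContainsK {G = G} (verts H) (C₂≤size⇒Clique H
      (ℕₚ.≤-reflexive (trans (cong (_C 2) (proj₁ k≡p×h≡C₂)) (sym (proj₂ k≡p×h≡C₂))))))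
    where
    k≡p×h≡C₂ = small-order-equality {{nonempty H}} k≤p (size≤order-C₂ H)
                                    (to (density≡⇔ H (p ∸ 1) 1) dH≡)

  spanning-subgraph⇒NonIsolatedCount : (H : Subgraph G) → p < order H →
    cliqueDensity p ℚ.≤ spanDensity p (e G) → density H ≡ spanDensity p (e G) →
    NonIsolatedCount G (suc p)
  spanning-subgraph⇒NonIsolatedCount H p<k clique≤span dH≡ =
    Covers⇒NonIsolatedCount {G = G} (e≤size⇒Covers H (ℕₚ.≤-reflexive (sym (proj₂ k≡×h≡e))))
                                    (proj₁ k≡×h≡e) C₂<e
    where
    C₂<e = clique≤span⇒C₂< p≥2 clique≤span
    instance _ = ℕ.>-nonZero (ℕₚ.≤-<-trans z≤n C₂<e)
    k≡×h≡e = large-order-equality p<k (size≤e H) (to (density≡⇔ H (2 * e G) (suc p)) dH≡)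

  madBound-attained⇒Extremal : (H : Subgraph G) → density H ≡ madBound p (e G) → Extremal p (e G) G
  madBound-attained⇒Extremal H dH≡ = case order H ℕ.≤? p of λ where
    (yes k≤p) → let dH≡clique , span≤clique = ⊔-attainedˡ (density≤cliqueDensity p H k≤p) dH≡ in
      inj₁ (span≤clique , clique-subgraph⇒ContainsK H k≤p dH≡clique)
    (no k≰p) → let p<k = ℕₚ.≰⇒> k≰p
                   dH≡span , clique≤span = ⊔-attainedʳ (density≤spanDensity p H p<k) dH≡ in
      inj₂ (clique≤span , spanning-subgraph⇒NonIsolatedCount H p<k clique≤span dH≡span)

  Extremal⇒madBound-attained : Extremal p (e G) G →
    Σ (Subgraph G) λ H → density H ≡ madBound p (e G)
  Extremal⇒madBound-attained (inj₁ (span≤clique , K)) = ContainsK⇒madBound-attained K span≤clique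
  Extremal⇒madBound-attained (inj₂ (clique≤span , N@(f , f-inj , _))) =
    H , spanning⇒density≡madBound H (injective⇒∣image∣≡ f-inj)
                                    (Covers⇒size-induced≡e {G = G} covers) clique≤span
    where
    instance _ = nonZero-image f-inj
    covers : Covers {G = G} (image f)
    covers = NonIsolatedCount⇒Covers {G = G} N
    H = induced (image f)

  isMad⇔Extremal : ∀ {m} → e G ≡ m → IsMad G (madBound p m) ⇔ Extremal p m G
  isMad⇔Extremal eG = subst (λ m → IsMad G (madBound p m) ⇔ Extremal p m G) eG (mk⇔
    (λ (_ , H , dH≡) → madBound-attained⇒Extremal H dH≡)
    (λ extremal → (λ H → density≤madBound p H) , Extremal⇒madBound-attained extremal))

module _ (p r : ℕ) where

  private
    starEdges : List (Fin (suc p) × Fin (suc p))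
    starEdges = map star (take r (allFin p))

    cliqueEdges : List (Fin (suc p) × Fin (suc p))
    cliqueEdges = map shift (pairs (⊤ {p}))

  -- Vertex 0 is joined to the first r vertices of a K_p on the vertices 1, …, p.
  Kp+star : Graph
  Kp+star = record
    { n       = suc p
    ; edges   = starEdges ++ cliqueEdges
    ; ordered = Allₚ.++⁺ (Allₚ.map⁺ (All.universal (λ _ → s≤s z≤n) _))
                         (Allₚ.map⁺ (All.map s≤s (pairs-ordered ⊤)))
    ; unique  = Uniqueₚ.++⁺ (Uniqueₚ.map⁺ star-injective (Uniqueₚ.take⁺ r (Uniqueₚ.allFin⁺ p)))
                            (Uniqueₚ.map⁺ shift-injective (pairs-unique ⊤))
                            (stars-shifts-disjoint _ (pairs ⊤))
    }

  e-Kp+star : r ≤ p → e Kp+star ≡ p C 2 + r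
  e-Kp+star r≤p = begin
    length (starEdges ++ cliqueEdges)      ≡⟨ Listₚ.length-++ starEdges ⟩
    length starEdges + length cliqueEdges  ≡⟨ cong₂ _+_ ∣stars∣≡r ∣clique∣≡C₂ ⟩
    r + p C 2                              ≡⟨ ℕₚ.+-comm r (p C 2) ⟩
    p C 2 + r                              ∎
    where
    open ≡-Reasoning
    ∣stars∣≡r : length starEdges ≡ r
    ∣stars∣≡r = trans (Listₚ.length-map star (take r (allFin p)))
      (trans (Listₚ.length-take r (allFin p))
      (trans (cong (r ℕ.⊓_) (Listₚ.length-tabulate {n = p} (λ x → x))) (ℕₚ.m≤n⇒m⊓n≡m r≤p)))
    ∣clique∣≡C₂ : length cliqueEdges ≡ p C 2
    ∣clique∣≡C₂ = trans (Listₚ.length-map shift (pairs (⊤ {p})))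
      (trans (length-pairs (⊤ {p})) (cong (_C 2) (Subsetₚ.∣⊤∣≡n p)))

  Kp+star-ContainsK : ContainsK p Kp+star
  Kp+star-ContainsK = subst (λ k → ContainsK k Kp+star) (Subsetₚ.∣⊤∣≡n p)
    (Clique⇒ContainsK {G = Kp+star} (false ∷ ⊤) (∈ₚ.∈-++⁺ʳ starEdges))

  Kp+star-spanning : Σ (Subgraph Kp+star) λ H → order H ≡ suc p × size H ≡ e Kp+star
  Kp+star-spanning = induced ⊤ , Subsetₚ.∣⊤∣≡n (suc p) ,
    Covers⇒size-induced≡e {G = Kp+star} (All.universal (λ _ → Subsetₚ.∈⊤ , Subsetₚ.∈⊤) _)

IsG-madBound : ∀ {p} → 2 ≤ p → ∀ {r} → r ≤ p → IsG (p C 2 + r) (madBound p (p C 2 + r))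
IsG-madBound {p} p≥2 {r} r≤p = upper , W , e-Kp+star p r r≤p ,
  subst (λ m → IsMad W (madBound p m)) (e-Kp+star p r r≤p) (density≤madBound p , attained)
  where
  W = Kp+star p r
  upper : ∀ G → e G ≡ p C 2 + r → ∀ q → IsMad G q → q ℚ.≤ madBound p (p C 2 + r)
  upper G eG q (_ , H , dH≡q) = subst₂ ℚ._≤_ dH≡q (cong (madBound p) eG) (density≤madBound p H)
  attained : Σ (Subgraph W) λ H → density H ≡ madBound p (e W)
  attained = case ℚₚ.≤-total (spanDensity p (e W)) (cliqueDensity p) of λ where
    (inj₁ span≤clique) → ContainsK⇒madBound-attained p≥2 (Kp+star-ContainsK p r) span≤clique
    (inj₂ clique≤span) → let H , k≡ , h≡e = Kp+star-spanning p r in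
      H , spanning⇒density≡madBound p≥2 H k≡ h≡e clique≤span

span≤clique-C₂ : ∀ p → spanDensity p (p C 2) ℚ.≤ cliqueDensity p
span≤clique-C₂ p = subst (λ m → spanDensity p m ℚ.≤ cliqueDensity p) (ℕₚ.+-identityʳ (p C 2))
  (from (span≤clique⇔ p 0) z≤n)

madBound-C₂ : ∀ p → madBound p (p C 2) ≡ cliqueDensity p
madBound-C₂ p = ℚₚ.p≥q⇒p⊔q≡p (span≤clique-C₂ p)

Extremal⇔IsKUpToIsolated : ∀ {p} → 2 ≤ p → (G : Graph) → e G ≡ p C 2 →
  Extremal p (p C 2) G ⇔ IsKUpToIsolated p G
Extremal⇔IsKUpToIsolated {p@(suc (suc _))} p≥2@(s≤s (s≤s z≤n)) G eG = mk⇔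
  (λ { (inj₁ (_ , K)) → ContainsK⇒IsKUpToIsolated {G = G} (ℕₚ.≤-reflexive eG) K
     ; (inj₂ (clique≤span , _)) →
         contradiction (clique≤span⇒C₂< p≥2 clique≤span) (ℕₚ.<-irrefl refl) })
  (λ (f , f-inj , adjacent , _) → inj₁ (span≤clique-C₂ p , f , f-inj , adjacent))

ExtremalCases : ℕ → ℕ → Graph → Set
ExtremalCases p r G = (2 * r < p ∸ 1 × ContainsK p G)
                    ⊎ (p ∸ 1 < 2 * r × NonIsolatedCount G (suc p))
                    ⊎ (2 * r ≡ p ∸ 1 × (ContainsK p G ⊎ NonIsolatedCount G (suc p)))

Extremal⇔ExtremalCases : ∀ p r (G : Graph) → Extremal p (p C 2 + r) G ⇔ ExtremalCases p r G
Extremal⇔ExtremalCases p r G = mk⇔ to′ from′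
  where
  to′ : Extremal p (p C 2 + r) G → ExtremalCases p r G
  to′ (inj₁ (span≤clique , K)) = case ℕₚ.m≤n⇒m<n∨m≡n (to (span≤clique⇔ p r) span≤clique) of λ where
    (inj₁ 2r<D) → inj₁ (2r<D , K)
    (inj₂ 2r≡D) → inj₂ (inj₂ (2r≡D , inj₁ K))
  to′ (inj₂ (clique≤span , N)) = case ℕₚ.m≤n⇒m<n∨m≡n (to (clique≤span⇔ p r) clique≤span) of λ where
    (inj₁ D<2r) → inj₂ (inj₁ (D<2r , N))
    (inj₂ D≡2r) → inj₂ (inj₂ (sym D≡2r , inj₂ N))
  from′ : ExtremalCases p r G → Extremal p (p C 2 + r) G
  from′ (inj₁ (2r<D , K))             = inj₁ (from (span≤clique⇔ p r) (ℕₚ.<⇒≤ 2r<D) , K)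
  from′ (inj₂ (inj₁ (D<2r , N)))      = inj₂ (from (clique≤span⇔ p r) (ℕₚ.<⇒≤ D<2r) , N)
  from′ (inj₂ (inj₂ (2r≡D , inj₁ K))) = inj₁ (from (span≤clique⇔ p r) (ℕₚ.≤-reflexive 2r≡D) , K)
  from′ (inj₂ (inj₂ (2r≡D , inj₂ N))) =
    inj₂ (from (clique≤span⇔ p r) (ℕₚ.≤-reflexive (sym 2r≡D)) , N)

theorem3p1 : (p : ℕ) → p ≥ 2 →
    (IsG (p C 2) ((+ (p ∸ 1)) / 1)
    × (∀ (G : Graph) → e G ≡ p C 2 → (IsMad G ((+ (p ∸ 1)) / 1) ⇔ IsKUpToIsolated p G)))
    × (∀ (r : ℕ) → 0 < r → r < p →
    IsG (p C 2 + r) (((+ (p ∸ 1)) / 1) ⊔ ((+ (2 * (p C 2 + r))) / suc p))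
    × (∀ (G : Graph) → e G ≡ p C 2 + r →
    (IsMad G (((+ (p ∸ 1)) / 1) ⊔ ((+ (2 * (p C 2 + r))) / suc p))
    ⇔ ((2 * r < p ∸ 1 × ContainsK p G)
    ⊎ (p ∸ 1 < 2 * r × NonIsolatedCount G (suc p))
    ⊎ (2 * r ≡ p ∸ 1 × (ContainsK p G ⊎ NonIsolatedCount G (suc p)))))))
theorem3p1 p p≥2 =
    ( subst (IsG (p C 2)) (madBound-C₂ p)
        (subst (λ m → IsG m (madBound p m)) (ℕₚ.+-identityʳ (p C 2)) (IsG-madBound p≥2 z≤n))
    , λ G eG → Extremal⇔IsKUpToIsolated p≥2 G eG
           ⇔-∘ subst (λ q → IsMad G q ⇔ Extremal p (p C 2) G) (madBound-C₂ p)
                     (isMad⇔Extremal p≥2 eG) )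
  , λ r _ r<p → IsG-madBound p≥2 (ℕₚ.<⇒≤ r<p)
              , λ G eG → Extremal⇔ExtremalCases p r G ⇔-∘ isMad⇔Extremal p≥2 eG
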